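{- Let $N \geq 1$ and let $G$ be a graph on $N$ vertices. Suppose the edges of $G$ are covered by $N$ pairwise edge-disjoint cliques of $G$ having $V_1, V_2, \ldots, V_N$ vertices respectively. Then $$\sum_{i=1}^{N} V_i \;\leq\; B(N) := N\, f^{ -1}(N-1),$$ where $f(M) = M(M-1)$ and $f^{ -1}$ denotes the inverse of $f$ restricted to $[1,\infty)$.
   Context: A clique of $G$ is a complete subgraph of $G$ with at least one vertex. Edge-disjoint means no edge of $G$ lies in two of the cliques; the cliques cover the edges of $G$ means every edge of $G$ lies in (exactly) one of them. The function $f(M)=M(M-1)$ is a strictly increasing bijection from $[1,\infty)$ onto $[0,\infty)$, so $f^{ -1}(N-1)$ is the unique $M \ge 1$ with $M(M-1)=N-1$. -}

module Defs where

open import Data.Nat using (ℕ; _+_; _*_; _∸_; _≤_)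
open import Data.Fin using (Fin)
open import Data.Fin.Subset using (Subset; _∈_; Nonempty; ∣_∣)
open import Data.List using (List; map; allFin)
open import Data.Nat.ListAction using (sum)
open import Data.Product using (Σ; _×_)
open import Data.Empty using (⊥)
open import Relation.Binary.PropositionalEquality using (_≡_; _≢_)

record Graph (N : ℕ) : Set₁ where
  field
    Adj    : Fin N → Fin N → Set
    irrefl : ∀ u → Adj u u → ⊥
    sym    : ∀ u v → Adj u v → Adj v u

open Graph public

IsClique : ∀ {N} → Graph N → Subset N → Set
IsClique G C = Nonempty C × (∀ u v → u ∈ C → v ∈ C → u ≢ v → Adj G u v)

EdgeIn : ∀ {N} → Fin N → Fin N → Subset N → Set
EdgeIn u v C = u ∈ C × v ∈ C

record EdgeCliqueDecomposition {N : ℕ} (G : Graph N) (K : ℕ) : Set₁ where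
  field
    clique   : Fin K → Subset N
    isClique : ∀ i → IsClique G (clique i)
    covers   : ∀ u v → Adj G u v → Σ (Fin K) (λ i → EdgeIn u v (clique i))
    disjoint : ∀ u v → Adj G u v → ∀ i j →
               EdgeIn u v (clique i) → EdgeIn u v (clique j) → i ≡ j

open EdgeCliqueDecomposition public

sizeSum : ∀ {N K} {G : Graph N} → EdgeCliqueDecomposition G K → ℕ
sizeSum {K = K} D = sum (map (λ i → ∣ clique D i ∣) (allFin K))

{-# OPTIONS --safe #-}
module Submission where

-- Σᵢ Vᵢ(Vᵢ − 1) counts ordered pairs of distinct vertices lying in a common clique, and by
-- edge-disjointness each of the N(N − 1) such pairs is counted at most once; with S = Σᵢ Vᵢ
-- this gives Σᵢ Vᵢ² ≤ S + N(N − 1). Cauchy–Schwarz over the N cliques then yields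
-- S² ≤ N Σᵢ Vᵢ² ≤ N S + N²(N − 1), i.e. (S/N)(S/N − 1) ≤ N − 1, which is S ≤ N f⁻¹(N − 1);
-- the statement records it without division as S(S − N) ≤ N²(N − 1).

open import Defs hiding (sym)
open import Data.Bool using (Bool; true; false; T; _∧_)
open import Data.Bool.Properties using (T-≡; T-∧; ∧-idem)
open import Data.Fin using (Fin; zero; suc)
import Data.Fin.Properties as Fin
open import Data.Fin.Subset using (Subset; _∈_; ∣_∣)
open import Data.List using (tabulate)
open import Data.List.Properties using (map-tabulate)
open import Data.Nat using (ℕ; zero; suc; _+_; _*_; _∸_; _≤_; z≤n; s≤s)
open import Data.Nat.Properties
import Data.Nat.ListAction as List
open import Data.Nat.Tactic.RingSolver using (solve-∀)
open import Data.Product using (_,_; proj₁; proj₂)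
open import Data.Vec using ([]; _∷_; lookup)
open import Data.Vec.Functional using (Vector; removeAt)
open import Data.Vec.Properties using (lookup⇒[]=)
open import Function using (_∘_; id; Equivalence)
open import Relation.Binary.PropositionalEquality
  using (_≡_; _≢_; refl; sym; trans; cong; cong₂; ≢-sym; module ≡-Reasoning)

open import Algebra.Properties.Semiring.Sum +-*-semiring
  using ( sum; sum-syntax; sum-cong-≗; sum-remove; sum-replicate-zero
        ; ∑-distrib-+; ∑-comm; *-distribˡ-sum; *-distribʳ-sum )

∑-mono-≤ : ∀ {n} {f g : Vector ℕ n} → (∀ i → f i ≤ g i) → ∑[ i < n ] f i ≤ ∑[ i < n ] g i
∑-mono-≤ {zero}  f≤g = z≤n
∑-mono-≤ {suc n} f≤g = +-mono-≤ (f≤g zero) (∑-mono-≤ (f≤g ∘ suc))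

∑-const : ∀ n c → ∑[ i < n ] c ≡ n * c
∑-const zero    c = refl
∑-const (suc n) c = cong (c +_) (∑-const n c)

sum-tabulate : ∀ {n} (f : Vector ℕ n) → List.sum (tabulate f) ≡ sum f
sum-tabulate {zero}  f = refl
sum-tabulate {suc n} f = cong (f zero +_) (sum-tabulate (f ∘ suc))

sum≤t[i]+[n∸1] : ∀ {n} (t : Vector ℕ n) i → (∀ j → j ≢ i → t j ≤ 1) → sum t ≤ t i + (n ∸ 1)
sum≤t[i]+[n∸1] {suc n} t i t≤1 = begin
  sum t                      ≡⟨ sum-remove t ⟩
  t i + sum (removeAt t i)   ≤⟨ +-monoʳ-≤ (t i) (∑-mono-≤ (λ j → t≤1 _ (Fin.punchInᵢ≢i i j))) ⟩
  t i + ∑[ j < n ] 1         ≡⟨ cong (t i +_) (trans (∑-const n 1) (*-identityʳ n)) ⟩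
  t i + n                    ∎
  where open ≤-Reasoning

2*m*n≤m*m+n*n : ∀ m n → 2 * (m * n) ≤ m * m + n * n
2*m*n≤m*m+n*n zero        n       = z≤n
2*m*n≤m*m+n*n m@(suc _)   zero    rewrite *-zeroʳ m = z≤n
2*m*n≤m*m+n*n (suc m)     (suc n) = begin
  2 * (suc m * suc n)                 ≡⟨ expand-lhs m n ⟩
  2 * (m * n) + 2 * (1 + m + n)       ≤⟨ +-monoˡ-≤ (2 * (1 + m + n)) (2*m*n≤m*m+n*n m n) ⟩
  m * m + n * n + 2 * (1 + m + n)     ≡⟨ expand-rhs m n ⟩
  suc m * suc m + suc n * suc n       ∎
  where
  open ≤-Reasoning
  expand-lhs : ∀ m n → 2 * (suc m * suc n) ≡ 2 * (m * n) + 2 * (1 + m + n)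
  expand-lhs = solve-∀
  expand-rhs : ∀ m n → m * m + n * n + 2 * (1 + m + n) ≡ suc m * suc m + suc n * suc n
  expand-rhs = solve-∀

sum*sum≡∑∑ : ∀ {m n} (f : Vector ℕ m) (g : Vector ℕ n) →
             sum f * sum g ≡ ∑[ i < m ] ∑[ j < n ] (f i * g j)
sum*sum≡∑∑ f g = trans (*-distribʳ-sum (sum g) f) (sum-cong-≗ (λ i → *-distribˡ-sum (f i) g))

sum*sum≤n*∑sq : ∀ {n} (a : Vector ℕ n) → sum a * sum a ≤ n * ∑[ i < n ] (a i * a i)
sum*sum≤n*∑sq {n} a = *-cancelˡ-≤ 2 (begin
  2 * (sum a * sum a)
    ≡⟨ cong (2 *_) (sum*sum≡∑∑ a a) ⟩
  2 * ∑[ i < n ] ∑[ j < n ] (a i * a j)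
    ≡⟨ *-distribˡ-sum 2 (λ i → ∑[ j < n ] (a i * a j)) ⟩
  ∑[ i < n ] (2 * ∑[ j < n ] (a i * a j))
    ≡⟨ sum-cong-≗ (λ i → *-distribˡ-sum 2 (λ j → a i * a j)) ⟩
  ∑[ i < n ] ∑[ j < n ] (2 * (a i * a j))
    ≤⟨ ∑-mono-≤ (λ i → ∑-mono-≤ (λ j → 2*m*n≤m*m+n*n (a i) (a j))) ⟩
  ∑[ i < n ] ∑[ j < n ] (a i * a i + a j * a j)
    ≡⟨ sum-cong-≗ (λ i → ∑-distrib-+ (λ _ → a i * a i) (λ j → a j * a j)) ⟩
  ∑[ i < n ] (∑[ j < n ] (a i * a i) + Q)
    ≡⟨ ∑-distrib-+ (λ i → ∑[ j < n ] (a i * a i)) (λ _ → Q) ⟩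
  ∑[ i < n ] ∑[ j < n ] (a i * a i) + ∑[ i < n ] Q
    ≡⟨ cong (_+ ∑[ i < n ] Q) (∑-comm {n} {n} (λ i _ → a i * a i)) ⟩
  ∑[ j < n ] Q + ∑[ i < n ] Q
    ≡⟨ cong₂ _+_ (∑-const n Q) (∑-const n Q) ⟩
  n * Q + n * Q
    ≡⟨ cong (n * Q +_) (+-identityʳ (n * Q)) ⟨
  2 * (n * Q) ∎)
  where
  open ≤-Reasoning
  Q = ∑[ i < n ] (a i * a i)

m*m≤n*[m+o]⇒m*[m∸n]≤n*o : ∀ m n o → m * m ≤ n * (m + o) → m * (m ∸ n) ≤ n * o
m*m≤n*[m+o]⇒m*[m∸n]≤n*o m n o m*m≤ = begin
  m * (m ∸ n)       ≡⟨ *-distribˡ-∸ m m n ⟩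
  m * m ∸ m * n     ≤⟨ m≤n+o⇒m∸n≤o (m * m) (m * n) (≤-trans m*m≤ (≤-reflexive n*[m+o]≡m*n+n*o)) ⟩
  n * o             ∎
  where
  open ≤-Reasoning
  n*[m+o]≡m*n+n*o : n * (m + o) ≡ m * n + n * o
  n*[m+o]≡m*n+n*o = trans (*-distribˡ-+ n m o) (cong (_+ n * o) (*-comm n m))

𝟙 : Bool → ℕ
𝟙 true  = 1
𝟙 false = 0

𝟙-*-𝟙 : ∀ x y → 𝟙 x * 𝟙 y ≡ 𝟙 (x ∧ y)
𝟙-*-𝟙 true  y = +-identityʳ (𝟙 y)
𝟙-*-𝟙 false y = refl

∑𝟙≤1 : ∀ {n} (b : Vector Bool n) → (∀ i j → T (b i) → T (b j) → i ≡ j) → ∑[ i < n ] 𝟙 (b i) ≤ 1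
∑𝟙≤1 {zero}  b unique = z≤n
∑𝟙≤1 {suc n} b unique = split (b zero) refl
  where
  split : ∀ x → b zero ≡ x → 𝟙 x + ∑[ i < n ] 𝟙 (b (suc i)) ≤ 1
  split false _   = ∑𝟙≤1 (b ∘ suc) (λ i j bᵢ bⱼ → Fin.suc-injective (unique (suc i) (suc j) bᵢ bⱼ))
  split true  b₀ = s≤s (≤-trans (∑-mono-≤ rest-false) (≤-reflexive (sum-replicate-zero n)))
    where
    rest-false : ∀ i → 𝟙 (b (suc i)) ≤ 0
    rest-false i with b (suc i) in bᵢ
    ... | false = z≤n
    ... | true  with unique zero (suc i) (Equivalence.from T-≡ b₀) (Equivalence.from T-≡ bᵢ)
    ... | ()

χ : ∀ {n} → Subset n → Vector ℕ n
χ p u = 𝟙 (lookup p u)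

∣p∣≡∑χ : ∀ {n} (p : Subset n) → ∣ p ∣ ≡ sum (χ p)
∣p∣≡∑χ []          = refl
∣p∣≡∑χ (true  ∷ p) = cong suc (∣p∣≡∑χ p)
∣p∣≡∑χ (false ∷ p) = ∣p∣≡∑χ p

∣p∣*∣p∣≡∑∑χχ : ∀ {n} (p : Subset n) → ∣ p ∣ * ∣ p ∣ ≡ ∑[ u < n ] ∑[ v < n ] (χ p u * χ p v)
∣p∣*∣p∣≡∑∑χχ p = trans (cong₂ _*_ (∣p∣≡∑χ p) (∣p∣≡∑χ p)) (sum*sum≡∑∑ (χ p) (χ p))

χ*χ≡χ : ∀ {n} (p : Subset n) u → χ p u * χ p u ≡ χ p u
χ*χ≡χ p u = trans (𝟙-*-𝟙 (lookup p u) (lookup p u)) (cong 𝟙 (∧-idem (lookup p u)))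

T-lookup⇒∈ : ∀ {n} {p : Subset n} {u} → T (lookup p u) → u ∈ p
T-lookup⇒∈ {p = p} {u} t = lookup⇒[]= u p (Equivalence.to T-≡ t)

T-∧-lookup⇒EdgeIn : ∀ {n} {p : Subset n} {u v} → T (lookup p u ∧ lookup p v) → EdgeIn u v p
T-∧-lookup⇒EdgeIn t = let (tᵤ , tᵥ) = Equivalence.to T-∧ t in T-lookup⇒∈ tᵤ , T-lookup⇒∈ tᵥ

CoversPairsAtMostOnce : ∀ {N K} → (Fin K → Subset N) → Set
CoversPairsAtMostOnce {N} C =
  ∀ {u v : Fin N} → u ≢ v → ∀ i j → EdgeIn u v (C i) → EdgeIn u v (C j) → i ≡ j

module _ {N K} {C : Fin K → Subset N} where

  multiplicity : Fin N → Fin N → ℕ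
  multiplicity u v = ∑[ i < K ] (χ (C i) u * χ (C i) v)

  ∑∑multiplicity≡∑∣C∣² : ∑[ u < N ] ∑[ v < N ] multiplicity u v ≡ ∑[ i < K ] (∣ C i ∣ * ∣ C i ∣)
  ∑∑multiplicity≡∑∣C∣² = begin
    ∑[ u < N ] ∑[ v < N ] ∑[ i < K ] (χ (C i) u * χ (C i) v)
      ≡⟨ sum-cong-≗ (λ u → ∑-comm (λ v i → χ (C i) u * χ (C i) v)) ⟩
    ∑[ u < N ] ∑[ i < K ] ∑[ v < N ] (χ (C i) u * χ (C i) v)
      ≡⟨ ∑-comm (λ u i → ∑[ v < N ] (χ (C i) u * χ (C i) v)) ⟩
    ∑[ i < K ] ∑[ u < N ] ∑[ v < N ] (χ (C i) u * χ (C i) v)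
      ≡⟨ sum-cong-≗ (λ i → sym (∣p∣*∣p∣≡∑∑χχ (C i))) ⟩
    ∑[ i < K ] (∣ C i ∣ * ∣ C i ∣) ∎
    where open ≡-Reasoning

  ∑multiplicity-diagonal : ∑[ u < N ] multiplicity u u ≡ ∑[ i < K ] ∣ C i ∣
  ∑multiplicity-diagonal = begin
    ∑[ u < N ] ∑[ i < K ] (χ (C i) u * χ (C i) u) ≡⟨ ∑-comm (λ u i → χ (C i) u * χ (C i) u) ⟩
    ∑[ i < K ] ∑[ u < N ] (χ (C i) u * χ (C i) u) ≡⟨ sum-cong-≗ (λ i → sum-cong-≗ (χ*χ≡χ (C i))) ⟩
    ∑[ i < K ] sum (χ (C i))                       ≡⟨ sum-cong-≗ (λ i → sym (∣p∣≡∑χ (C i))) ⟩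
    ∑[ i < K ] ∣ C i ∣                            ∎
    where open ≡-Reasoning

  module _ (once : CoversPairsAtMostOnce C) where

    multiplicity≤1 : ∀ {u v} → u ≢ v → multiplicity u v ≤ 1
    multiplicity≤1 {u} {v} u≢v = begin
      multiplicity u v                               ≡⟨ sum-cong-≗ (λ i → 𝟙-*-𝟙 (lookup (C i) u) (lookup (C i) v)) ⟩
      ∑[ i < K ] 𝟙 (lookup (C i) u ∧ lookup (C i) v) ≤⟨ ∑𝟙≤1 _ unique ⟩
      1                                              ∎
      where
      open ≤-Reasoning
      unique : ∀ i j → T (lookup (C i) u ∧ lookup (C i) v) → T (lookup (C j) u ∧ lookup (C j) v) → i ≡ j
      unique i j tᵢ tⱼ = once u≢v i j (T-∧-lookup⇒EdgeIn tᵢ) (T-∧-lookup⇒EdgeIn tⱼ)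

    ∑∣C∣²≤∑∣C∣+N*[N∸1] : ∑[ i < K ] (∣ C i ∣ * ∣ C i ∣) ≤ ∑[ i < K ] ∣ C i ∣ + N * (N ∸ 1)
    ∑∣C∣²≤∑∣C∣+N*[N∸1] = begin
      ∑[ i < K ] (∣ C i ∣ * ∣ C i ∣)                   ≡⟨ ∑∑multiplicity≡∑∣C∣² ⟨
      ∑[ u < N ] ∑[ v < N ] multiplicity u v          ≤⟨ ∑-mono-≤ row≤diagonal+[N∸1] ⟩
      ∑[ u < N ] (multiplicity u u + (N ∸ 1))         ≡⟨ ∑-distrib-+ (λ u → multiplicity u u) (λ _ → N ∸ 1) ⟩
      ∑[ u < N ] multiplicity u u + ∑[ u < N ] (N ∸ 1) ≡⟨ cong₂ _+_ ∑multiplicity-diagonal (∑-const N (N ∸ 1)) ⟩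
      ∑[ i < K ] ∣ C i ∣ + N * (N ∸ 1)                 ∎
      where
      open ≤-Reasoning
      row≤diagonal+[N∸1] : ∀ u → ∑[ v < N ] multiplicity u v ≤ multiplicity u u + (N ∸ 1)
      row≤diagonal+[N∸1] u = sum≤t[i]+[n∸1] (multiplicity u) u (λ v v≢u → multiplicity≤1 (≢-sym v≢u))

module _ {N K} {G : Graph N} (D : EdgeCliqueDecomposition G K) where

  cliques-coverPairsAtMostOnce : CoversPairsAtMostOnce (clique D)
  cliques-coverPairsAtMostOnce {u} {v} u≢v i j uv∈Cᵢ uv∈Cⱼ =
    disjoint D u v (proj₂ (isClique D i) u v (proj₁ uv∈Cᵢ) (proj₂ uv∈Cᵢ) u≢v) i j uv∈Cᵢ uv∈Cⱼ

  sizeSum≡∑∣clique∣ : sizeSum D ≡ ∑[ i < K ] ∣ clique D i ∣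
  sizeSum≡∑∣clique∣ = trans (cong List.sum (map-tabulate id ∣clique∣)) (sum-tabulate ∣clique∣)
    where
    ∣clique∣ : Fin K → ℕ
    ∣clique∣ i = ∣ clique D i ∣

  sizeSum²≤K*[sizeSum+N*[N∸1]] : sizeSum D * sizeSum D ≤ K * (sizeSum D + N * (N ∸ 1))
  sizeSum²≤K*[sizeSum+N*[N∸1]] rewrite sizeSum≡∑∣clique∣ = begin
    S * S
      ≤⟨ sum*sum≤n*∑sq (λ i → ∣ clique D i ∣) ⟩
    K * ∑[ i < K ] (∣ clique D i ∣ * ∣ clique D i ∣)
      ≤⟨ *-monoʳ-≤ K (∑∣C∣²≤∑∣C∣+N*[N∸1] cliques-coverPairsAtMostOnce) ⟩
    K * (S + N * (N ∸ 1)) ∎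
    where
    open ≤-Reasoning
    S = ∑[ i < K ] ∣ clique D i ∣

theorem1 : (N : ℕ) → 1 ≤ N → (G : Graph N) → (D : EdgeCliqueDecomposition G N) →
    sizeSum D * (sizeSum D ∸ N) ≤ N * N * (N ∸ 1)
theorem1 N _ G D = begin
  S * (S ∸ N)        ≤⟨ m*m≤n*[m+o]⇒m*[m∸n]≤n*o S N (N * (N ∸ 1)) (sizeSum²≤K*[sizeSum+N*[N∸1]] D) ⟩
  N * (N * (N ∸ 1))  ≡⟨ *-assoc N N (N ∸ 1) ⟨
  N * N * (N ∸ 1)    ∎
  where
  open ≤-Reasoning
  S = sizeSum D
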